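{- For every positive integer $n$, there is exactly one ballot permutation of length $n$ avoiding both patterns $132$ and $231$, i.e. $|B_n(132,231)|=1$.
   Context: A permutation $\sigma\in S_n$ is written as $\sigma(1)\cdots\sigma(n)$. An index $i\in[n-1]$ is an ascent if $\sigma(i)<\sigma(i+1)$ and a descent if $\sigma(i)>\sigma(i+1)$. A ballot permutation is a permutation such that every prefix $\sigma(1)\cdots\sigma(p)$ has at least as many ascents as descents. $\sigma$ contains a pattern $\pi\in S_k$ if some subsequence $\sigma(c_1)\cdots\sigma(c_k)$ with $c_1<\dots<c_k$ is order-isomorphic to $\pi$, and avoids $\pi$ otherwise. $B_n(\pi_1,\dots,\pi_m)$ denotes the set of ballot permutations of length $n$ avoiding all of $\pi_1,\dots,\pi_m$. -}

module Defs where

open import Data.Nat using (ℕ; zero; suc; _≤_)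
open import Data.Fin using (Fin; toℕ; inject₁) renaming (zero to fz; suc to fs)
open import Data.Fin as F using ()
open import Data.Fin.Permutation using (Permutation′; _⟨$⟩ʳ_)
open import Data.List using (List; []; length; filter; map; allFin)
open import Data.Product using (_×_; _,_; proj₁; proj₂; ∃)
open import Data.Vec using (Vec; _∷_; []; lookup)
open import Function.Bundles using (_⇔_)
open import Relation.Binary.PropositionalEquality using (_≡_)
open import Relation.Unary using (Pred)
open import Relation.Nullary using (¬_)

-- A permutation of length n: a bijection on Fin n (positions and values 0-indexed).
Perm : ℕ → Set
Perm n = Permutation′ n

adjPairs : (n : ℕ) → List (Fin n × Fin n)
adjPairs zero = []
adjPairs (suc m) = map (λ i → inject₁ i , fs i) (allFin m)

prefixPairs : (n p : ℕ) → List (Fin n × Fin n)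
prefixPairs n p = filter (λ ij → suc (toℕ (proj₂ ij)) Data.Nat.≤? p) (adjPairs n)
  where import Data.Nat

ascentsIn : ∀ {n} → Perm n → ℕ → ℕ
ascentsIn {n} σ p =
  length (filter (λ ij → (σ ⟨$⟩ʳ proj₁ ij) F.<? (σ ⟨$⟩ʳ proj₂ ij)) (prefixPairs n p))

descentsIn : ∀ {n} → Perm n → ℕ → ℕ
descentsIn {n} σ p =
  length (filter (λ ij → (σ ⟨$⟩ʳ proj₂ ij) F.<? (σ ⟨$⟩ʳ proj₁ ij)) (prefixPairs n p))

IsBallot : ∀ {n} → Perm n → Set
IsBallot {n} σ = ∀ p → p ≤ n → descentsIn σ p ≤ ascentsIn σ p

Contains : ∀ {n k} → Perm n → (Fin k → Fin k) → Set
Contains {n} {k} σ π =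
  ∃ λ (c : Fin k → Fin n) →
    (∀ a b → a F.< b → c a F.< c b) ×
    (∀ a b → (π a F.< π b) ⇔ ((σ ⟨$⟩ʳ c a) F.< (σ ⟨$⟩ʳ c b)))

Avoids : ∀ {n k} → Perm n → (Fin k → Fin k) → Set
Avoids σ π = ¬ Contains σ π

-- the patterns 132 and 231 (0-indexed values)
p132 : Fin 3 → Fin 3
p132 = lookup (fz ∷ fs (fs fz) ∷ fs fz ∷ [])

p231 : Fin 3 → Fin 3
p231 = lookup (fs fz ∷ fs (fs fz) ∷ fz ∷ [])

InB-132-231 : ∀ {n} → Perm n → Set
InB-132-231 σ = IsBallot σ × Avoids σ p132 × Avoids σ p231

_≈ₚ_ : ∀ {n} → Perm n → Perm n → Set
_≈ₚ_ {n} σ τ = ∀ i → σ ⟨$⟩ʳ i ≡ τ ⟨$⟩ʳ i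

-- The two patterns 132 and 231 together forbid every peak σ(a) < σ(b) > σ(c) with a < b < c,
-- whichever of σ(a), σ(c) is smaller. The ballot condition on the prefix of length 2 forces
-- σ(1) < σ(2); with no peaks, each ascent propagates to the next adjacent pair, so σ is
-- increasing and hence the identity. Conversely the identity has no descents and contains
-- only increasing patterns.
module Submission where

open import Defs
open import Data.Nat using (ℕ; suc; _≤_)
open import Data.Product using (∃; _×_)

open import Data.Nat using (zero; _<_; z≤n; s≤s; z<s; s<s)
import Data.Nat.Properties as NP
open import Data.Fin as F using (Fin; toℕ; inject₁) renaming (zero to fz; suc to fs)
import Data.Fin.Properties as FP
open import Data.Fin.Permutation using (_⟨$⟩ʳ_; _⟨$⟩ˡ_; inverseˡ; inverseʳ; id)
open import Data.List using ([]; _∷_; length; filter)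
open import Data.List.Relation.Unary.All as All using (All)
import Data.List.Relation.Unary.All.Properties as AllP
import Data.List.Properties as LP
open import Data.Vec using ([]; _∷_; lookup)
open import Data.Product using (_,_; proj₁; proj₂)
open import Data.Empty using (⊥)
open import Function using (_∘_)
open import Function.Bundles using (_⇔_; mk⇔; Equivalence)
open import Function.Definitions using (Injective)
open import Relation.Binary.Core using (_Preserves_⟶_)
open import Relation.Binary.Definitions using (tri<; tri≈; tri>)
open import Relation.Binary.PropositionalEquality
  using (_≡_; _≢_; refl; sym; trans; cong; subst; subst₂; module ≡-Reasoning)
open import Relation.Nullary using (¬_; Dec; yes; no; contradiction)

StrictlyIncreasing : ∀ {m n} → (Fin m → Fin n) → Set
StrictlyIncreasing f = f Preserves F._<_ ⟶ F._<_

PeakFree : ∀ {m n} → (Fin m → Fin n) → Set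
PeakFree g = ∀ {a b c} → a F.< b → b F.< c → g a F.< g b → g c F.< g b → ⊥

⟨$⟩ʳ-injective : ∀ {n} (σ : Perm n) → Injective _≡_ _≡_ (σ ⟨$⟩ʳ_)
⟨$⟩ʳ-injective σ σx≡σy =
  trans (sym (inverseˡ σ)) (trans (cong (σ ⟨$⟩ˡ_) σx≡σy) (inverseˡ σ))

injective-≮⇒> : ∀ {m n} {g : Fin m → Fin n} → Injective _≡_ _≡_ g →
  ∀ {x y} → x ≢ y → ¬ g x F.< g y → g y F.< g x
injective-≮⇒> inj x≢y ¬gx<gy = FP.≤∧≢⇒< (NP.≮⇒≥ ¬gx<gy) (x≢y ∘ sym ∘ inj)

increasing-reflects : ∀ {m n} {f : Fin m → Fin n} → StrictlyIncreasing f →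
  ∀ {x y} → f x F.< f y → x F.< y
increasing-reflects f-inc {x} {y} fx<fy with FP.<-cmp x y
... | tri< x<y _ _ = x<y
... | tri≈ _ refl _ = contradiction fx<fy (FP.<-irrefl refl)
... | tri> _ _ y<x = contradiction fx<fy (FP.<-asym (f-inc y<x))

increasing-inflationary : ∀ {m n} {f : Fin m → Fin n} → StrictlyIncreasing f →
  ∀ i → toℕ i ≤ toℕ (f i)
increasing-inflationary f-inc fz = z≤n
increasing-inflationary {f = f} f-inc (fs i) =
  NP.≤-trans (s≤s (increasing-inflationary {f = f ∘ inject₁} (f-inc ∘ inject₁-mono) i))
             (f-inc (FP.≤̄⇒inject₁< FP.≤-refl))
  where
  inject₁-mono : ∀ {x y : Fin _} → x F.< y → inject₁ x F.< inject₁ y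
  inject₁-mono {x} {y} = subst₂ _<_ (sym (FP.toℕ-inject₁ x)) (sym (FP.toℕ-inject₁ y))

increasing-perm≗id : ∀ {n} (τ : Perm n) → StrictlyIncreasing (τ ⟨$⟩ʳ_) → ∀ i → τ ⟨$⟩ʳ i ≡ i
increasing-perm≗id τ τ-inc i =
  FP.toℕ-injective (NP.≤-antisym τi≤i (increasing-inflationary τ-inc i))
  where
  inverse-inc : StrictlyIncreasing (τ ⟨$⟩ˡ_)
  inverse-inc x<y = increasing-reflects τ-inc (subst₂ F._<_ (sym (inverseʳ τ)) (sym (inverseʳ τ)) x<y)

  τi≤i : toℕ (τ ⟨$⟩ʳ i) ≤ toℕ i
  τi≤i = subst (λ j → toℕ (τ ⟨$⟩ʳ i) ≤ toℕ j) (inverseˡ τ)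
           (increasing-inflationary inverse-inc (τ ⟨$⟩ʳ i))

ascents⇒increasing : ∀ {m n} (f : Fin (suc m) → Fin n) →
  (∀ i → f (inject₁ i) F.< f (fs i)) → StrictlyIncreasing f
ascents⇒increasing f asc {fz} {fz} ()
ascents⇒increasing f asc {fz} {fs fz} _ = asc fz
ascents⇒increasing {suc _} f asc {fz} {fs (fs j)} _ =
  FP.<-trans (asc fz) (ascents⇒increasing (f ∘ fs) (asc ∘ fs) {fz} {fs j} z<s)
ascents⇒increasing f asc {fs i} {fz} ()
ascents⇒increasing {suc _} f asc {fs i} {fs j} (s<s i<j) =
  ascents⇒increasing (f ∘ fs) (asc ∘ fs) i<j

-- Without peaks a descent can never follow an ascent.
peakFree-ascents : ∀ {m n} (g : Fin (suc (suc m)) → Fin n) → Injective _≡_ _≡_ g → PeakFree g →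
  g fz F.< g (fs fz) → ∀ i → g (inject₁ i) F.< g (fs i)
peakFree-ascents g inj noPeak asc₀ fz = asc₀
peakFree-ascents {suc _} g inj noPeak asc₀ (fs i) =
  peakFree-ascents (g ∘ fs) (FP.suc-injective ∘ inj)
    (λ a<b b<c → noPeak (s<s a<b) (s<s b<c)) asc₁ i
  where
  asc₁ : g (fs fz) F.< g (fs (fs fz))
  asc₁ = injective-≮⇒> inj (λ ()) (noPeak z<s (s<s z<s) asc₀)

triple : ∀ {n} → Fin n → Fin n → Fin n → Fin 3 → Fin n
triple a b c = lookup (a ∷ b ∷ c ∷ [])

triple-increasing : ∀ {n} {a b c : Fin n} → a F.< b → b F.< c → StrictlyIncreasing (triple a b c)
triple-increasing a<b b<c {fz}         {fz}         ()
triple-increasing a<b b<c {fz}         {fs fz}      _ = a<b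
triple-increasing a<b b<c {fz}         {fs (fs fz)} _ = FP.<-trans a<b b<c
triple-increasing a<b b<c {fs fz}      {fz}         ()
triple-increasing a<b b<c {fs fz}      {fs fz}      (s<s ())
triple-increasing a<b b<c {fs fz}      {fs (fs fz)} _ = b<c
triple-increasing a<b b<c {fs (fs fz)} {fz}         ()
triple-increasing a<b b<c {fs (fs fz)} {fs fz}      (s<s ())
triple-increasing a<b b<c {fs (fs fz)} {fs (fs fz)} (s<s (s<s ()))

-- φ lists the values of the occurrence in increasing order.
occurrence⇒Contains : ∀ {n k} (σ : Perm n) (π : Fin k → Fin k) (c φ : Fin k → Fin n) →
  StrictlyIncreasing c → StrictlyIncreasing φ → (∀ x → σ ⟨$⟩ʳ c x ≡ φ (π x)) → Contains σ π
occurrence⇒Contains σ π c φ c-inc φ-inc σc≗φπ =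
  c , (λ _ _ → c-inc) , λ a b →
    subst₂ (λ u v → (π a F.< π b) ⇔ (u F.< v)) (sym (σc≗φπ a)) (sym (σc≗φπ b))
      (mk⇔ φ-inc (increasing-reflects φ-inc))

avoids-132-231⇒peakFree : ∀ {n} (σ : Perm n) → Avoids σ p132 → Avoids σ p231 → PeakFree (σ ⟨$⟩ʳ_)
avoids-132-231⇒peakFree σ ¬132 ¬231 {a} {b} {c} a<b b<c σa<σb σc<σb
  with FP.<-cmp (σ ⟨$⟩ʳ a) (σ ⟨$⟩ʳ c)
... | tri< σa<σc _ _ =
  ¬132 (occurrence⇒Contains σ p132 (triple a b c) (triple _ _ _)
         (triple-increasing a<b b<c) (triple-increasing σa<σc σc<σb)
         λ { fz → refl ; (fs fz) → refl ; (fs (fs fz)) → refl })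
... | tri≈ _ σa≡σc _ = FP.<⇒≢ (FP.<-trans a<b b<c) (⟨$⟩ʳ-injective σ σa≡σc)
... | tri> _ _ σc<σa =
  ¬231 (occurrence⇒Contains σ p231 (triple a b c) (triple _ _ _)
         (triple-increasing a<b b<c) (triple-increasing σc<σa σa<σb)
         λ { fz → refl ; (fs fz) → refl ; (fs (fs fz)) → refl })

adjPairs-increasing : ∀ n → All (λ (ij : Fin n × Fin n) → proj₁ ij F.< proj₂ ij) (adjPairs n)
adjPairs-increasing zero = All.[]
adjPairs-increasing (suc m) = AllP.map⁺ (AllP.tabulate⁺ (λ i → FP.≤̄⇒inject₁< FP.≤-refl))

increasing⇒ballot : ∀ {n} (σ : Perm n) → StrictlyIncreasing (σ ⟨$⟩ʳ_) → IsBallot σ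
increasing⇒ballot {n} σ σ-inc p _ =
  subst (_≤ ascentsIn σ p) (sym no-descents) z≤n
  where
  no-descents : descentsIn σ p ≡ 0
  no-descents = cong length
    (LP.filter-none (λ (ij : Fin n × Fin n) → σ ⟨$⟩ʳ proj₂ ij F.<? σ ⟨$⟩ʳ proj₁ ij)
      (All.map (FP.<-asym ∘ σ-inc) (AllP.filter⁺ _ (adjPairs-increasing n))))

prefixPairs-2 : ∀ m → prefixPairs (suc (suc m)) 2 ≡ (fz , fs fz) ∷ []
prefixPairs-2 m = cong ((fz , fs fz) ∷_)
  (LP.filter-none (λ (ij : Fin (suc (suc m)) × Fin (suc (suc m))) → suc (toℕ (proj₂ ij)) NP.≤? 2)
    (AllP.map⁺ (AllP.tabulate⁺ {n = m} λ _ → λ { (s≤s (s≤s ())) })))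

ballot⇒first-ascent : ∀ {m} (σ : Perm (suc (suc m))) → IsBallot σ → σ ⟨$⟩ʳ fz F.< σ ⟨$⟩ʳ fs fz
ballot⇒first-ascent {m} σ ballot with σ ⟨$⟩ʳ fz F.<? σ ⟨$⟩ʳ fs fz
... | yes asc = asc
... | no ¬asc =
  contradiction (ballot 2 (s≤s (s≤s z≤n)))
    (subst₂ (λ d a → ¬ d ≤ a) (sym one-descent) (sym no-ascent) λ ())
  where
  open ≡-Reasoning
  Pair : Set
  Pair = Fin (suc (suc m)) × Fin (suc (suc m))

  ascent? : (ij : Pair) → Dec (σ ⟨$⟩ʳ proj₁ ij F.< σ ⟨$⟩ʳ proj₂ ij)
  ascent? ij = σ ⟨$⟩ʳ proj₁ ij F.<? σ ⟨$⟩ʳ proj₂ ij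

  descent? : (ij : Pair) → Dec (σ ⟨$⟩ʳ proj₂ ij F.< σ ⟨$⟩ʳ proj₁ ij)
  descent? ij = σ ⟨$⟩ʳ proj₂ ij F.<? σ ⟨$⟩ʳ proj₁ ij

  one-descent : descentsIn σ 2 ≡ 1
  one-descent = begin
    length (filter descent? (prefixPairs _ 2))  ≡⟨ cong (length ∘ filter descent?) (prefixPairs-2 m) ⟩
    length (filter descent? ((fz , fs fz) ∷ [])) ≡⟨ cong length (LP.filter-accept descent? σ₁<σ₀) ⟩
    1                                            ∎
    where
    σ₁<σ₀ : σ ⟨$⟩ʳ fs fz F.< σ ⟨$⟩ʳ fz
    σ₁<σ₀ = injective-≮⇒> (⟨$⟩ʳ-injective σ) (λ ()) ¬asc

  no-ascent : ascentsIn σ 2 ≡ 0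
  no-ascent = begin
    length (filter ascent? (prefixPairs _ 2))  ≡⟨ cong (length ∘ filter ascent?) (prefixPairs-2 m) ⟩
    length (filter ascent? ((fz , fs fz) ∷ [])) ≡⟨ cong length (LP.filter-reject ascent? ¬asc) ⟩
    0                                           ∎

InB-132-231⇒increasing : ∀ {n} (σ : Perm n) → InB-132-231 σ → StrictlyIncreasing (σ ⟨$⟩ʳ_)
InB-132-231⇒increasing {zero} σ _ {()}
InB-132-231⇒increasing {suc zero} σ _ = ascents⇒increasing (σ ⟨$⟩ʳ_) λ ()
InB-132-231⇒increasing {suc (suc _)} σ (ballot , ¬132 , ¬231) =
  ascents⇒increasing (σ ⟨$⟩ʳ_)
    (peakFree-ascents (σ ⟨$⟩ʳ_) (⟨$⟩ʳ-injective σ) (avoids-132-231⇒peakFree σ ¬132 ¬231)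
      (ballot⇒first-ascent σ ballot))

increasing⇒pattern-increasing : ∀ {n k} (σ : Perm n) {π : Fin k → Fin k} →
  StrictlyIncreasing (σ ⟨$⟩ʳ_) → Contains σ π → StrictlyIncreasing π
increasing⇒pattern-increasing σ σ-inc (c , c-inc , iso) a<b =
  Equivalence.from (iso _ _) (σ-inc (c-inc _ _ a<b))

p132-not-increasing : ¬ StrictlyIncreasing p132
p132-not-increasing inc with inc {fs fz} {fs (fs fz)} (s<s (s<s z≤n))
... | s<s ()

p231-not-increasing : ¬ StrictlyIncreasing p231
p231-not-increasing inc with inc {fz} {fs (fs fz)} z<s
... | ()

theorem3p9 : (n : ℕ) → 1 ≤ n →
    ∃ λ (σ : Perm n) → InB-132-231 σ × (∀ (τ : Perm n) → InB-132-231 τ → τ ≈ₚ σ)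
theorem3p9 n _ = id , id∈B , λ τ τ∈B → increasing-perm≗id τ (InB-132-231⇒increasing τ τ∈B)
  where
  id-increasing : StrictlyIncreasing (id {n} ⟨$⟩ʳ_)
  id-increasing x<y = x<y

  id∈B : InB-132-231 (id {n})
  id∈B = increasing⇒ballot id id-increasing
       , p132-not-increasing ∘ increasing⇒pattern-increasing id id-increasing
       , p231-not-increasing ∘ increasing⇒pattern-increasing id id-increasing
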